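{- For every integer $n\ge 1$ let $a_n$ be the smallest positive integer such that $n+a_n$ is prime, and let $P_n=\prod_{i=1}^n a_i$. Let $p_k$ denote the $k$-th prime, $d_k=p_{k+1}-p_k$, and $\pi(x)$ the number of primes $\le x$. Then for every prime $n\ge 3$, \[ P_{n-1}=\prod_{k=1}^{\pi(n)-1} d_k!, \] and for every composite integer $n\ge 4$, \[ P_{n-1}=\prod_{k=1}^{\pi(n)-1} d_k!\;\prod_{k=1}^{n-p_{\pi(n)}}\bigl(p_{\pi(n)+1}-p_{\pi(n)}-k+1\bigr). \]
   Context: $p_1=2,p_2=3,\dots$ are the primes in increasing order. -}

module Defs where

open import Data.Nat using (ℕ; zero; suc; _+_; _*_; _∸_; _≤_; _<_)
open import Data.Nat.Primality using (Prime; prime?)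

open import Relation.Nullary using (¬_)
open import Relation.Nullary.Decidable using (does)
open import Data.Bool using (if_then_else_)
open import Data.Product using (_×_)

IsLeastPrimeGap : (ℕ → ℕ) → Set
IsLeastPrimeGap a = ∀ n → 1 ≤ n →
  (1 ≤ a n) × Prime (n + a n) × (∀ b → 1 ≤ b → b < a n → ¬ Prime (n + b))

-- p k : the k-th prime, 1-indexed (p 1 = 2, p 2 = 3, ...): p is strictly
-- increasing on k ≥ 1, hits only primes, and every prime is some p k (k ≥ 1).
IsPrimeEnumeration : (ℕ → ℕ) → Set
IsPrimeEnumeration p =
  (∀ k → 1 ≤ k → Prime (p k)) ×
  (∀ k → 1 ≤ k → p k < p (suc k)) ×
  (∀ q → Prime q → Data.Product.Σ ℕ (λ k → (1 ≤ k) × (p k ≡ q)))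
  where open import Relation.Binary.PropositionalEquality using (_≡_)

π : ℕ → ℕ
π zero = 0
π (suc x) = (if does (prime? (suc x)) then 1 else 0) + π x

prod1 : ℕ → (ℕ → ℕ) → ℕ
prod1 zero f = 1
prod1 (suc m) f = prod1 m f * f (suc m)

Pprod : (ℕ → ℕ) → ℕ → ℕ
Pprod a n = prod1 n a

gap : (ℕ → ℕ) → ℕ → ℕ
gap p k = p (suc k) ∸ p k

module Submission where

-- The whole proposition rests
-- on one observation: a counts down on every prime gap, i.e. if
-- p m ≤ i < p (m+1) then a i = p (m+1) − i.  So the block of a-values
-- indexed by the m-th gap [p m, p (m+1)) is d m, d m − 1, …, 1, whose
-- product is d m !, and the first t values of the block multiply to the
-- falling product d m (d m − 1) ⋯ (d m − t + 1).
--
-- The composite case is this formula verbatim; for prime n we have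
-- n = p (π n), so the second product is empty.

open import Defs
open import Data.Nat using (ℕ; zero; suc; _+_; _*_; _∸_; _≤_; _<_; _!; z≤n; s≤s)
open import Data.Nat.Base using (nonTrivial⇒n>1)
open import Data.Nat.Properties
open import Data.Nat.Primality using (Prime; Composite; prime?; prime[2]; prime⇒nonTrivial)
open import Data.Product using (_×_; _,_; proj₁; proj₂)
open import Data.Sum using (inj₁; inj₂)
open import Data.Empty using (⊥-elim)
open import Relation.Nullary using (¬_; yes; no)
open import Relation.Binary.PropositionalEquality

prime⇒2≤ : ∀ {q} → Prime q → 2 ≤ q
prime⇒2≤ {q} q-prime = nonTrivial⇒n>1 q {{prime⇒nonTrivial q-prime}}

∸1-split : ∀ {P Q} → 1 ≤ P → P ≤ Q → Q ∸ 1 ≡ P ∸ 1 + (Q ∸ P)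
∸1-split {suc s} {Q} _ P≤Q = cong (_∸ 1) (sym (m+[n∸m]≡n P≤Q))

∸-suc-+1 : ∀ {x Q} → x < Q → Q ∸ suc x + 1 ≡ Q ∸ x
∸-suc-+1 {x} {Q} x<Q = trans (sym (+-∸-comm 1 x<Q)) (cong (_∸ suc x) (+-comm Q 1))

prod1-split : ∀ s t f → prod1 (s + t) f ≡ prod1 s f * prod1 t (λ k → f (s + k))
prod1-split s zero f rewrite +-identityʳ s = sym (*-identityʳ _)
prod1-split s (suc t) f rewrite +-suc s t =
  trans (cong (_* f (suc (s + t))) (prod1-split s t f)) (*-assoc (prod1 s f) _ _)

prod1-cong : ∀ t {f g} → (∀ k → 1 ≤ k → k ≤ t → f k ≡ g k) → prod1 t f ≡ prod1 t g
prod1-cong zero f≗g = refl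
prod1-cong (suc t) f≗g =
  cong₂ _*_ (prod1-cong t (λ k 1≤k k≤t → f≗g k 1≤k (m≤n⇒m≤1+n k≤t)))
            (f≗g (suc t) (s≤s z≤n) ≤-refl)

falling-factorial : ∀ t c → prod1 t (λ k → t + c ∸ k + 1) * c ! ≡ (t + c) !
falling-factorial zero c = *-identityˡ (c !)
falling-factorial (suc t) c = begin
    prod1 t F * (suc (t + c) ∸ suc t + 1) * c !
  ≡⟨ cong (λ x → prod1 t F * (x + 1) * c !) (m+n∸m≡n t c) ⟩
    prod1 t F * (c + 1) * c !
  ≡⟨ *-assoc (prod1 t F) (c + 1) (c !) ⟩
    prod1 t F * ((c + 1) * c !)
  ≡⟨ cong (λ x → prod1 t F * (x * c !)) (+-comm c 1) ⟩
    prod1 t F * suc c !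
  ≡⟨ subst (λ N → prod1 t (λ k → N ∸ k + 1) * suc c ! ≡ N !) (+-suc t c)
           (falling-factorial t (suc c)) ⟩
    suc (t + c) ! ∎
  where
  open ≡-Reasoning
  F : ℕ → ℕ
  F k = suc (t + c) ∸ k + 1

countdown-factorial : ∀ d → prod1 d (λ k → d ∸ k + 1) ≡ d !
countdown-factorial d =
  trans (sym (*-identityʳ _))
        (subst (λ N → prod1 d (λ k → N ∸ k + 1) * 1 ≡ N !) (+-identityʳ d)
               (falling-factorial d 0))

countdown-block : ∀ {P Q} (f : ℕ → ℕ) → 1 ≤ P → P ≤ Q →
  (∀ i → P ≤ i → i < Q → f i ≡ Q ∸ i) →
  ∀ t → t ≤ Q ∸ P → prod1 t (λ k → f (P ∸ 1 + k)) ≡ prod1 t (λ k → Q ∸ P ∸ k + 1)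
countdown-block {suc s} {Q} f _ P≤Q f-countdown t t≤Q∸P = prod1-cong t value
  where
  value : ∀ k → 1 ≤ k → k ≤ t → f (s + k) ≡ Q ∸ suc s ∸ k + 1
  value (suc j) _ k≤t = begin
      f (s + suc j)
    ≡⟨ f-countdown (s + suc j) P≤i i<Q ⟩
      Q ∸ (s + suc j)
    ≡⟨ sym (∸-suc-+1 i<Q) ⟩
      Q ∸ (suc s + suc j) + 1
    ≡⟨ cong (_+ 1) (sym (∸-+-assoc Q (suc s) (suc j))) ⟩
      Q ∸ suc s ∸ suc j + 1 ∎
    where
    open ≡-Reasoning
    P≤i : suc s ≤ s + suc j
    P≤i = subst (suc s ≤_) (sym (+-suc s j)) (s≤s (m≤m+n s j))
    i<Q : s + suc j < Q
    i<Q = subst (suc s + suc j ≤_) (m+[n∸m]≡n P≤Q)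
                (+-monoʳ-≤ (suc s) (≤-trans k≤t t≤Q∸P))

π-suc-prime : ∀ x → Prime (suc x) → π (suc x) ≡ suc (π x)
π-suc-prime x sx-prime with prime? (suc x)
... | yes _ = refl
... | no sx-not-prime = ⊥-elim (sx-not-prime sx-prime)

π-suc-not-prime : ∀ x → ¬ Prime (suc x) → π (suc x) ≡ π x
π-suc-not-prime x sx-not-prime with prime? (suc x)
... | yes sx-prime = ⊥-elim (sx-not-prime sx-prime)
... | no _ = refl

module PrimeGaps (p : ℕ → ℕ) (E : IsPrimeEnumeration p) where

  p-prime : ∀ k → 1 ≤ k → Prime (p k)
  p-prime = proj₁ E

  p-increasing : ∀ k → 1 ≤ k → p k < p (suc k)
  p-increasing = proj₁ (proj₂ E)

  p-positive : ∀ k → 1 ≤ k → 1 ≤ p k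
  p-positive k 1≤k = ≤-trans (s≤s z≤n) (prime⇒2≤ (p-prime k 1≤k))

  p-monotone : ∀ {m k} → 1 ≤ m → m ≤ k → p m ≤ p k
  p-monotone {m} {zero} 1≤m m≤0 = ⊥-elim (<⇒≱ 1≤m m≤0)
  p-monotone {m} {suc k} 1≤m m≤k+1 with m≤n⇒m<n∨m≡n m≤k+1
  ... | inj₂ refl = ≤-refl
  ... | inj₁ (s≤s m≤k) =
    ≤-trans (p-monotone 1≤m m≤k) (<⇒≤ (p-increasing k (≤-trans 1≤m m≤k)))

  next-prime : ∀ {m q} → 1 ≤ m → Prime q → p m < q → p (suc m) ≤ q
  next-prime {m} 1≤m q-prime pm<q with proj₂ (proj₂ E) _ q-prime
  ... | k , 1≤k , refl = p-monotone (s≤s z≤n) (≰⇒> k≰m)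
    where
    k≰m : ¬ k ≤ m
    k≰m k≤m = <⇒≱ pm<q (p-monotone 1≤k k≤m)

  no-prime-in-gap : ∀ {m x} → 1 ≤ m → p m < x → x < p (suc m) → ¬ Prime x
  no-prime-in-gap 1≤m pm<x x<next x-prime = <⇒≱ x<next (next-prime 1≤m x-prime pm<x)

  p₁≡2 : p 1 ≡ 2
  p₁≡2 with proj₂ (proj₂ E) 2 prime[2]
  ... | k , 1≤k , pk≡2 =
    ≤-antisym (subst (p 1 ≤_) pk≡2 (p-monotone ≤-refl 1≤k)) (prime⇒2≤ (p-prime 1 ≤-refl))

  InGap : ℕ → ℕ → Set
  InGap m n = 1 ≤ m × p m ≤ n × n < p (suc m)

  -- If x lies in the gap with index π x, so does x + 1: either x + 1 is
  -- still inside the gap (and not prime), or it is the next prime.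
  in-gap-step : ∀ x → InGap (π x) x → InGap (π (suc x)) (suc x)
  in-gap-step x (1≤m , pm≤x , x<next) with m≤n⇒m<n∨m≡n x<next
  ... | inj₁ x+1<next
    rewrite π-suc-not-prime x (no-prime-in-gap 1≤m (s≤s pm≤x) x+1<next) =
      1≤m , m≤n⇒m≤1+n pm≤x , x+1<next
  ... | inj₂ x+1≡next
    rewrite π-suc-prime x (subst Prime (sym x+1≡next) (p-prime _ (s≤s z≤n))) =
      s≤s z≤n , ≤-reflexive (sym x+1≡next) ,
      subst (_< p _) (sym x+1≡next) (p-increasing _ (s≤s z≤n))

  in-gap-π : ∀ n → 2 ≤ n → InGap (π n) n
  in-gap-π (suc zero) (s≤s ())
  in-gap-π (suc (suc zero)) _ =
    ≤-refl , ≤-reflexive p₁≡2 , subst (_< p 2) p₁≡2 (p-increasing 1 ≤-refl)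
  in-gap-π (suc (suc (suc n))) _ =
    in-gap-step (suc (suc n)) (in-gap-π (suc (suc n)) (s≤s (s≤s z≤n)))

  prime-starts-gap : ∀ {m n} → Prime n → InGap m n → p m ≡ n
  prime-starts-gap n-prime (1≤m , pm≤n , n<next) with m≤n⇒m<n∨m≡n pm≤n
  ... | inj₁ pm<n = ⊥-elim (no-prime-in-gap 1≤m pm<n n<next n-prime)
  ... | inj₂ pm≡n = pm≡n

module LeastPrimeGaps (a p : ℕ → ℕ) (A : IsLeastPrimeGap a) (E : IsPrimeEnumeration p) where
  open PrimeGaps p E

  gap! : ℕ → ℕ
  gap! k = gap p k !

  -- a counts down on every prime gap: the next prime after i is p (m + 1).
  a-countdown : ∀ {m i} → InGap m i → a i ≡ p (suc m) ∸ i
  a-countdown {m} {i} (1≤m , pm≤i , i<next) = ≤-antisym a≤ ≤a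
    where
    1≤i : 1 ≤ i
    1≤i = ≤-trans (p-positive m 1≤m) pm≤i
    a-least : ∀ b → 1 ≤ b → b < a i → ¬ Prime (i + b)
    a-least = proj₂ (proj₂ (A i 1≤i))
    a≤ : a i ≤ p (suc m) ∸ i
    a≤ = ≮⇒≥ λ gap<a → a-least _ (m<n⇒0<n∸m i<next) gap<a
           (subst Prime (sym (m+[n∸m]≡n (<⇒≤ i<next))) (p-prime (suc m) (s≤s z≤n)))
    ≤a : p (suc m) ∸ i ≤ a i
    ≤a = subst (p (suc m) ∸ i ≤_) (m+n∸m≡n i (a i))
           (∸-monoˡ-≤ i (next-prime 1≤m (proj₁ (proj₂ (A i 1≤i)))
                                    (≤-<-trans pm≤i (m<m+n i (proj₁ (A i 1≤i))))))

  a₁≡1 : a 1 ≡ 1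
  a₁≡1 = ≤-antisym (≮⇒≥ λ 1<a → proj₂ (proj₂ (A 1 ≤-refl)) 1 ≤-refl 1<a prime[2])
                   (proj₁ (A 1 ≤-refl))

  P-before-prime : ∀ m → 1 ≤ m → prod1 (p m ∸ 1) a ≡ prod1 (m ∸ 1) gap!
  P-within-gap : ∀ m → 1 ≤ m → ∀ t → t ≤ gap p m →
    prod1 (p m ∸ 1 + t) a ≡ prod1 (m ∸ 1) gap! * prod1 t (λ k → gap p m ∸ k + 1)

  P-before-prime (suc zero) _ rewrite p₁≡2 = trans (*-identityˡ (a 1)) a₁≡1
  P-before-prime (suc (suc m)) _ = begin
      prod1 (p (suc (suc m)) ∸ 1) a
    ≡⟨ cong (λ x → prod1 x a) (∸1-split (p-positive (suc m) (s≤s z≤n))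
                                         (<⇒≤ (p-increasing (suc m) (s≤s z≤n)))) ⟩
      prod1 (p (suc m) ∸ 1 + gap p (suc m)) a
    ≡⟨ P-within-gap (suc m) (s≤s z≤n) (gap p (suc m)) ≤-refl ⟩
      prod1 m gap! * prod1 (gap p (suc m)) (λ k → gap p (suc m) ∸ k + 1)
    ≡⟨ cong (prod1 m gap! *_) (countdown-factorial (gap p (suc m))) ⟩
      prod1 m gap! * gap! (suc m) ∎
    where open ≡-Reasoning

  P-within-gap m 1≤m t t≤gap = begin
      prod1 (p m ∸ 1 + t) a
    ≡⟨ prod1-split (p m ∸ 1) t a ⟩
      prod1 (p m ∸ 1) a * prod1 t (λ k → a (p m ∸ 1 + k))
    ≡⟨ cong₂ _*_ (P-before-prime m 1≤m)
                 (countdown-block a (p-positive m 1≤m) (<⇒≤ (p-increasing m 1≤m))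
                    (λ i pm≤i i<next → a-countdown (1≤m , pm≤i , i<next)) t t≤gap) ⟩
      prod1 (m ∸ 1) gap! * prod1 t (λ k → gap p m ∸ k + 1) ∎
    where open ≡-Reasoning

  P-formula : ∀ n → 2 ≤ n →
    Pprod a (n ∸ 1) ≡
      prod1 (π n ∸ 1) gap! * prod1 (n ∸ p (π n)) (λ k → gap p (π n) ∸ k + 1)
  P-formula n 2≤n =
    trans (cong (λ x → prod1 x a) (∸1-split (p-positive (π n) 1≤m) pm≤n))
          (P-within-gap (π n) 1≤m (n ∸ p (π n)) (∸-monoˡ-≤ (p (π n)) (<⇒≤ n<next)))
    where
    n-in-gap : InGap (π n) n
    n-in-gap = in-gap-π n 2≤n
    1≤m : 1 ≤ π n
    1≤m = proj₁ n-in-gap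
    pm≤n : p (π n) ≤ n
    pm≤n = proj₁ (proj₂ n-in-gap)
    n<next : n < p (suc (π n))
    n<next = proj₂ (proj₂ n-in-gap)

proposition3 : (a p : ℕ → ℕ) → IsLeastPrimeGap a → IsPrimeEnumeration p →
    (∀ n → Prime n → 3 ≤ n →
      Pprod a (n ∸ 1) ≡ prod1 (π n ∸ 1) (λ k → (gap p k) !)) ×
    (∀ n → Composite n → 4 ≤ n →
      Pprod a (n ∸ 1) ≡
        prod1 (π n ∸ 1) (λ k → (gap p k) !) *
        prod1 (n ∸ p (π n)) (λ k → p (suc (π n)) ∸ p (π n) ∸ k + 1))
proposition3 a p A E = prime-case , composite-case
  where
  open PrimeGaps p E
  open LeastPrimeGaps a p A E

  -- For prime n we have n = p (π n), so the trailing product is empty.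
  prime-case : ∀ n → Prime n → 3 ≤ n → Pprod a (n ∸ 1) ≡ prod1 (π n ∸ 1) gap!
  prime-case n n-prime 3≤n = begin
      Pprod a (n ∸ 1)
    ≡⟨ P-formula n 2≤n ⟩
      prod1 (π n ∸ 1) gap! * prod1 (n ∸ p (π n)) (λ k → gap p (π n) ∸ k + 1)
    ≡⟨ cong (λ t → prod1 (π n ∸ 1) gap! * prod1 t (λ k → gap p (π n) ∸ k + 1)) empty ⟩
      prod1 (π n ∸ 1) gap! * 1
    ≡⟨ *-identityʳ _ ⟩
      prod1 (π n ∸ 1) gap! ∎
    where
    open ≡-Reasoning
    2≤n : 2 ≤ n
    2≤n = ≤-trans (n≤1+n 2) 3≤n
    empty : n ∸ p (π n) ≡ 0
    empty = m≤n⇒m∸n≡0 (≤-reflexive (sym (prime-starts-gap n-prime (in-gap-π n 2≤n))))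

  composite-case : ∀ n → Composite n → 4 ≤ n →
    Pprod a (n ∸ 1) ≡
      prod1 (π n ∸ 1) gap! * prod1 (n ∸ p (π n)) (λ k → gap p (π n) ∸ k + 1)
  composite-case n _ 4≤n = P-formula n (≤-trans (s≤s (s≤s z≤n)) 4≤n)
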